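{- Let $p$ be a prime, let $l,n\in\mathbb{N}$ and $r\in\mathbb{Z}$. If $n>lp$, then $$F^{(l)}_p(n,r)\equiv(-1)^l\binom{\lfloor(n-l-1)/(p-1)\rfloor}{l}F_p(n-lp,r)\pmod p.$$
   Context: For a prime $p$, $l,n\in\mathbb{N}$ and $r\in\mathbb{Z}$, $$F^{(l)}_p(n,r)=(-p)^{ -\lfloor (n-lp-1)/(p-1)\rfloor}\sum_{k\equiv r\,(\mathrm{mod}\ p)}\binom nk(-1)^k\binom{(k-r)/p}{l},$$ which is an integer. The Fleck quotient is $F_p(n,r)=(-p)^{ -\lfloor (n-1)/(p-1)\rfloor}\sum_{k\equiv r\,(\mathrm{mod}\ p)}\binom nk(-1)^k+[\![n=0]\!]$, where $[\![A]\!]$ is $1$ if $A$ holds and $0$ otherwise. -}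

module Defs where

open import Data.Bool using (Bool; true; false; if_then_else_)
open import Data.Nat as ℕ using (ℕ; zero; suc)
open import Data.Nat.Combinatorics using (_C_)
open import Data.Integer
  using (ℤ; +_; -[1+_]; _+_; _-_; _*_; -_; _^_; _/ℕ_; _%ℕ_; 0ℤ; 1ℤ)

-- Floor division of an integer by a natural number d (d ≥ 1 in all uses;
-- the d = 0 case is a dummy value). _/ℕ_ is floor division.
fdiv : ℤ → ℕ → ℤ
fdiv i zero    = 0ℤ
fdiv i (suc d) = i /ℕ suc d

-- Does d divide the integer i ?  (dummy for d = 0; d = p prime in all uses)
divides? : ℕ → ℤ → Bool
divides? zero    i = false
divides? (suc d) i with i %ℕ suc d
... | zero  = true
... | suc _ = false

-- Generalised binomial coefficient  binom(x, l) = x(x-1)...(x-l+1)/l!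
-- for integer top x:  binom(m,l) = m C l for m ≥ 0, and
-- binom(-(a+1), l) = (-1)^l binom(a+l, l).
binomℤ : ℤ → ℕ → ℤ
binomℤ (+ m)     l = + (m C l)
binomℤ -[1+ a ]  l = (- 1ℤ) ^ l * + ((a ℕ.+ l) C l)

sumTo : ℕ → (ℕ → ℤ) → ℤ
sumTo zero    f = f zero
sumTo (suc n) f = sumTo n f + f (suc n)

-- For e = m ≥ 0 this is the (exact, by the integrality theorem) division
-- by (-p)^m = (-1)^m p^m; for e < 0 it is multiplication by (-p)^{-e}.
scaleNegP : ℕ → ℤ → ℤ → ℤ
scaleNegP p (+ m)     S = (- 1ℤ) ^ m * fdiv S (p ℕ.^ m)
scaleNegP p -[1+ m ]  S = S * (- (+ p)) ^ suc m

-- The sum  Σ_{k ≡ r (mod p)} C(n,k) (-1)^k binom((k-r)/p, l)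
-- (C(n,k) = 0 unless 0 ≤ k ≤ n).
flSum : ℕ → ℕ → ℕ → ℤ → ℤ
flSum l p n r =
  sumTo n (λ k → if divides? p (+ k - r)
                 then + (n C k) * (- 1ℤ) ^ k * binomℤ (fdiv (+ k - r) p) l
                 else 0ℤ)

F⁽_⁾ : ℕ → ℕ → ℕ → ℤ → ℤ
F⁽ l ⁾ p n r =
  scaleNegP p (fdiv (+ n - + (l ℕ.* p) - 1ℤ) (p ℕ.∸ 1)) (flSum l p n r)

Fleck : ℕ → ℕ → ℤ → ℤ
Fleck p n r =
  scaleNegP p (fdiv (+ n - 1ℤ) (p ℕ.∸ 1))
    (sumTo n (λ k → if divides? p (+ k - r) then + (n C k) * (- 1ℤ) ^ k else 0ℤ))
  + iverson n
  where
  iverson : ℕ → ℤ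
  iverson zero    = 1ℤ
  iverson (suc _) = 0ℤ

module Submission where

-- Write ∇ f x = f x − f (x − 1) and g_l y = binom(−y/p, l) if p ∣ y, 0 otherwise; the sum in
-- F⁽ l ⁾ p n r is then S⁽ l ⁾ n r = ∇ⁿ g_l r.  As (−1)^k C(p−1,k) ≡ 1 (mod p), the defect
-- ∇^{p−1} f − Σ_{j<p} f (· − j) is a convolution with coefficients divisible by p, so it turns
-- p^e-divisibility of f into p^{e+1}-divisibility.  Telescoping the window sum gives
-- ∇^{p+n} f = defect (∇^{n+1} f) + ∇ⁿ (f − f (· − p)), and Pascal's rule gives
-- g_{l+1} − g_{l+1} (· − p) = −g_l and g_0 − g_0 (· − p) = 0.  Induction on e yields Fleck's
-- theorem p^e ∣ S⁽ 0 ⁾ n for n = 1 + e(p−1) + s, and a double induction on l and e yields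
-- p^{e+1} ∣ S⁽ l ⁾ (lp + n) − binom(−e−1, l) S⁽ 0 ⁾ n.  Dividing by (−p)^e gives the theorem,
-- because (−1)^l binom(e+l, l) = binom(−e−1, l).

open import Defs

module FleckQuotients where

  open import Data.Bool using (true; false; if_then_else_)
  open import Data.Nat as ℕ using (ℕ; zero; suc; _≤_; _<_; z≤n; s≤s)
  import Data.Nat.Properties as ℕ
  import Data.Nat.Divisibility as ℕ
  import Data.Nat.Tactic.RingSolver as ℕ-Solver
  open import Data.Nat.Combinatorics
    using (_C_; nCk+nC[k+1]≡[n+1]C[k+1]; k>n⇒nCk≡0; nCn≡1; nC1≡n)
  open import Data.Nat.DivMod using (m≡m%n+[m/n]*n; m%n<n)
  open import Data.Nat.Primality using (Prime; euclidsLemma)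
  open import Data.Integer as ℤ
    using (ℤ; +_; -[1+_]; _+_; _-_; _*_; -_; _^_; 0ℤ; 1ℤ; _/ℕ_; _%ℕ_)
  open import Data.Integer.Properties
    using ( +-0-abelianGroup; +-injective; +-comm; +-assoc; +-identityˡ; +-identityʳ
          ; *-identityˡ; *-identityʳ; *-zeroʳ; *-distribˡ-+; pos-+; pos-*; suc-*
          ; <-cmp; <⇒≢; i≤j+i; i<j⇒suc[i]≤j; +-monoˡ-<; *-monoʳ-≤-nonNeg; module ≤-Reasoning)
  open import Algebra.Properties.AbelianGroup +-0-abelianGroup using (∙-cancelʳ)
  open import Data.Integer.DivMod using (a≡a%ℕn+[a/ℕn]*n; n%ℕd<d)
  open import Data.Integer.Divisibility.Signed
    using ( _∣_; divides; ∣ᵤ⇒∣; ∣-trans; ∣m∣n⇒∣m+n; ∣m∣n⇒∣m-n; ∣n⇒∣m*n; ∣m⇒∣m*n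
          ; *-monoˡ-∣; *-monoʳ-∣)
  open import Data.Integer.Tactic.RingSolver using (solve-∀)
  open import Data.Product using (∃₂; _×_; _,_; proj₁; proj₂)
  open import Data.Sum using (inj₁; inj₂)
  open import Relation.Binary.Definitions using (tri<; tri≈; tri>)
  open import Relation.Binary.PropositionalEquality
  open import Relation.Nullary using (contradiction)

  private
    *-distribˡ-minus : ∀ a b c → a * (b - c) ≡ a * b - a * c
    *-distribˡ-minus = solve-∀

    *-distribʳ-minus : ∀ a b c → (a - b) * c ≡ a * c - b * c
    *-distribʳ-minus = solve-∀

    x-k-1≡x-[1+k] : ∀ x k → x - + k - 1ℤ ≡ x - + suc k
    x-k-1≡x-[1+k] x k = reorder x (+ k)
      where
      reorder : ∀ x k → x - k - 1ℤ ≡ x - (1ℤ + k)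
      reorder = solve-∀

  -- Floor division and divisibility

  module _ (m : ℕ) .{{_ : ℕ.NonZero m}} where

    private
      quotient-dominates : ∀ {q q′} r r′ → r < m → q ℤ.< q′ → + r + q * + m ℤ.< + r′ + q′ * + m
      quotient-dominates {q} {q′} r r′ r<m q<q′ = begin-strict
        + r + q * + m    <⟨ +-monoˡ-< (q * + m) (ℤ.+<+ r<m) ⟩
        + m + q * + m    ≡⟨ suc-* q (+ m) ⟨
        ℤ.suc q * + m    ≤⟨ *-monoʳ-≤-nonNeg (+ m) (i<j⇒suc[i]≤j q<q′) ⟩
        q′ * + m         ≤⟨ i≤j+i (q′ * + m) (+ r′) ⟩
        + r′ + q′ * + m  ∎
        where open ≤-Reasoning

    %ℕ-/ℕ-unique : ∀ x q r → r < m → x ≡ + r + q * + m → x %ℕ m ≡ r × x /ℕ m ≡ q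
    %ℕ-/ℕ-unique x q r r<m x≡r+qm with <-cmp (x /ℕ m) q
    ... | tri< x/m<q _ _ = contradiction (trans (sym (a≡a%ℕn+[a/ℕn]*n x m)) x≡r+qm)
                                         (<⇒≢ (quotient-dominates _ r (n%ℕd<d x m) x/m<q))
    ... | tri> _ _ q<x/m = contradiction (trans (sym x≡r+qm) (a≡a%ℕn+[a/ℕn]*n x m))
                                         (<⇒≢ (quotient-dominates r _ r<m q<x/m))
    ... | tri≈ _ refl _  = +-injective (∙-cancelʳ (q * + m) _ _ (trans (sym (a≡a%ℕn+[a/ℕn]*n x m)) x≡r+qm))
                         , refl

    private
      %ℕ-/ℕ-+m : ∀ x → (x + + m) %ℕ m ≡ x %ℕ m × (x + + m) /ℕ m ≡ x /ℕ m + 1ℤ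
      %ℕ-/ℕ-+m x = %ℕ-/ℕ-unique (x + + m) (x /ℕ m + 1ℤ) (x %ℕ m) (n%ℕd<d x m)
        (trans (cong (_+ + m) (a≡a%ℕn+[a/ℕn]*n x m)) (shift (+ (x %ℕ m)) (x /ℕ m) (+ m)))
        where
        shift : ∀ r q m → r + q * m + m ≡ r + (q + 1ℤ) * m
        shift = solve-∀

    [x+m]%ℕm≡x%ℕm : ∀ x → (x + + m) %ℕ m ≡ x %ℕ m
    [x+m]%ℕm≡x%ℕm x = proj₁ (%ℕ-/ℕ-+m x)

    [x+m]/ℕm≡x/ℕm+1 : ∀ x → (x + + m) /ℕ m ≡ x /ℕ m + 1ℤ
    [x+m]/ℕm≡x/ℕm+1 x = proj₂ (%ℕ-/ℕ-+m x)

  fdiv-exact : ∀ m x .{{_ : ℕ.NonZero m}} → fdiv (x * + m) m ≡ x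
  fdiv-exact (suc m) x = proj₂ (%ℕ-/ℕ-unique (suc m) (x * + suc m) x 0 (s≤s z≤n) (sym (+-identityˡ _)))

  fdiv-affine : ∀ m e s → s < m → fdiv (+ (e ℕ.* m ℕ.+ s)) m ≡ + e
  fdiv-affine (suc m) e s s<m = proj₂ (%ℕ-/ℕ-unique (suc m) _ (+ e) s s<m (begin
    + (e ℕ.* suc m ℕ.+ s)     ≡⟨ pos-+ (e ℕ.* suc m) s ⟩
    + (e ℕ.* suc m) + + s     ≡⟨ +-comm (+ (e ℕ.* suc m)) (+ s) ⟩
    + s + + (e ℕ.* suc m)     ≡⟨ cong (_+_ (+ s)) (pos-* e (suc m)) ⟩
    + s + + e * + suc m       ∎))
    where open ≡-Reasoning

  +[a+suc[c]]-+a-1≡+c : ∀ a c → + (a ℕ.+ suc c) - + a - 1ℤ ≡ + c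
  +[a+suc[c]]-+a-1≡+c a c = trans (cong (λ z → z - + a - 1ℤ) (pos-+ a (suc c))) (cancel (+ a) (+ c))
    where
    cancel : ∀ a c → a + (1ℤ + c) - a - 1ℤ ≡ c
    cancel = solve-∀

  fdiv-congruence : ∀ p q A B c .{{_ : ℕ.NonZero q}} →
                    + q ∣ B → + p * + q ∣ A - c * B → + p ∣ fdiv A q - c * fdiv B q
  fdiv-congruence p q A B c (divides b refl) (divides t A-cB≡t[pq]) = divides t (begin
    fdiv A q - c * fdiv (b * + q) q              ≡⟨ cong (λ y → fdiv A q - c * y) (fdiv-exact q b) ⟩
    fdiv A q - c * b                             ≡⟨ cong (λ y → fdiv y q - c * b) A≡[tp+cb]q ⟩
    fdiv ((t * + p + c * b) * + q) q - c * b     ≡⟨ cong (_- c * b) (fdiv-exact q (t * + p + c * b)) ⟩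
    t * + p + c * b - c * b                      ≡⟨ cancel (t * + p) (c * b) ⟩
    t * + p                                      ∎)
    where
    open ≡-Reasoning
    cancel : ∀ x y → x + y - y ≡ x
    cancel = solve-∀
    split : ∀ x y → x ≡ x - y + y
    split = solve-∀
    factor : ∀ t p c b q → t * (p * q) + c * (b * q) ≡ (t * p + c * b) * q
    factor = solve-∀
    A≡[tp+cb]q : A ≡ (t * + p + c * b) * + q
    A≡[tp+cb]q = begin
      A                                   ≡⟨ split A (c * (b * + q)) ⟩
      A - c * (b * + q) + c * (b * + q)   ≡⟨ cong (_+ c * (b * + q)) A-cB≡t[pq] ⟩
      t * (+ p * + q) + c * (b * + q)     ≡⟨ factor t (+ p) c b (+ q) ⟩
      (t * + p + c * b) * + q             ∎

  1∣ : ∀ x → + 1 ∣ x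
  1∣ x = divides x (sym (*-identityʳ x))

  ∣-combine : ∀ {m D A B b₁ b₂} → m ∣ D - b₁ * B → m ∣ A - b₂ * B → m ∣ D - A - (b₁ - b₂) * B
  ∣-combine {m} {D} {A} {B} {b₁} {b₂} m∣D-b₁B m∣A-b₂B =
    subst (m ∣_) (regroup D A B b₁ b₂) (∣m∣n⇒∣m-n m∣D-b₁B m∣A-b₂B)
    where
    regroup : ∀ D A B b₁ b₂ → D - b₁ * B - (A - b₂ * B) ≡ D - A - (b₁ - b₂) * B
    regroup = solve-∀

  a<n⇒n≡a+suc[e*d+s] : ∀ d .{{_ : ℕ.NonZero d}} {a n} → a < n →
                       ∃₂ λ e s → s < d × n ≡ a ℕ.+ suc (e ℕ.* d ℕ.+ s)
  a<n⇒n≡a+suc[e*d+s] d {a} {n} a<n = m ℕ./ d , m ℕ.% d , m%n<n m d , (begin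
    n                                      ≡⟨ ℕ.m+[n∸m]≡n a<n ⟨
    suc a ℕ.+ m                            ≡⟨ ℕ.+-suc a m ⟨
    a ℕ.+ suc m                            ≡⟨ cong (λ k → a ℕ.+ suc k) m≡[m/d]*d+m%d ⟩
    a ℕ.+ suc (m ℕ./ d ℕ.* d ℕ.+ m ℕ.% d)  ∎)
    where
    open ≡-Reasoning
    m = n ℕ.∸ suc a
    m≡[m/d]*d+m%d : m ≡ m ℕ./ d ℕ.* d ℕ.+ m ℕ.% d
    m≡[m/d]*d+m%d = trans (m≡m%n+[m/n]*n m d) (ℕ.+-comm (m ℕ.% d) _)

  -- Finite sums

  sumTo-cong : ∀ n {f g : ℕ → ℤ} → f ≗ g → sumTo n f ≡ sumTo n g
  sumTo-cong zero    f≗g = f≗g 0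
  sumTo-cong (suc n) f≗g = cong₂ _+_ (sumTo-cong n f≗g) (f≗g (suc n))

  sumTo-distrib-+ : ∀ n (f g : ℕ → ℤ) → sumTo n (λ k → f k + g k) ≡ sumTo n f + sumTo n g
  sumTo-distrib-+ zero    f g = refl
  sumTo-distrib-+ (suc n) f g =
    trans (cong (_+ (f (suc n) + g (suc n))) (sumTo-distrib-+ n f g))
          (interchange (sumTo n f) (sumTo n g) (f (suc n)) (g (suc n)))
    where
    interchange : ∀ a b c d → a + b + (c + d) ≡ a + c + (b + d)
    interchange = solve-∀

  sumTo-distrib-minus : ∀ n (f g : ℕ → ℤ) → sumTo n (λ k → f k - g k) ≡ sumTo n f - sumTo n g
  sumTo-distrib-minus zero    f g = refl
  sumTo-distrib-minus (suc n) f g =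
    trans (cong (_+ (f (suc n) - g (suc n))) (sumTo-distrib-minus n f g))
          (interchange (sumTo n f) (sumTo n g) (f (suc n)) (g (suc n)))
    where
    interchange : ∀ a b c d → a - b + (c - d) ≡ a + c - (b + d)
    interchange = solve-∀

  *-distribˡ-sumTo : ∀ n a (f : ℕ → ℤ) → a * sumTo n f ≡ sumTo n (λ k → a * f k)
  *-distribˡ-sumTo zero    a f = refl
  *-distribˡ-sumTo (suc n) a f =
    trans (*-distribˡ-+ a (sumTo n f) (f (suc n))) (cong (_+ a * f (suc n)) (*-distribˡ-sumTo n a f))

  sumTo-shift : ∀ n (f : ℕ → ℤ) → sumTo (suc n) f ≡ f 0 + sumTo n (λ k → f (suc k))
  sumTo-shift zero    f = refl
  sumTo-shift (suc n) f = trans (cong (_+ f (suc (suc n))) (sumTo-shift n f)) (+-assoc (f 0) _ _)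

  sumTo-telescope : ∀ n (f : ℕ → ℤ) → sumTo n (λ k → f k - f (suc k)) ≡ f 0 - f (suc n)
  sumTo-telescope zero    f = refl
  sumTo-telescope (suc n) f = trans (cong (_+ (f (suc n) - f (suc (suc n)))) (sumTo-telescope n f))
                                    (collapse (f 0) (f (suc n)) (f (suc (suc n))))
    where
    collapse : ∀ a b c → a - b + (b - c) ≡ a - c
    collapse = solve-∀

  ∣-sumTo : ∀ {a} n (f : ℕ → ℤ) → (∀ k → k ≤ n → a ∣ f k) → a ∣ sumTo n f
  ∣-sumTo zero    f a∣f = a∣f 0 z≤n
  ∣-sumTo (suc n) f a∣f =
    ∣m∣n⇒∣m+n (∣-sumTo n f (λ k k≤n → a∣f k (ℕ.m≤n⇒m≤1+n k≤n))) (a∣f (suc n) ℕ.≤-refl)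

  -- Binomial coefficients

  [k+1]*[n+1]C[k+1]≡[n+1]*nCk : ∀ n k → suc k ℕ.* (suc n C suc k) ≡ suc n ℕ.* (n C k)
  [k+1]*[n+1]C[k+1]≡[n+1]*nCk zero    zero    = refl
  [k+1]*[n+1]C[k+1]≡[n+1]*nCk zero    (suc k)
    rewrite k>n⇒nCk≡0 {1} {suc (suc k)} (s≤s (s≤s z≤n)) = ℕ.*-zeroʳ (suc (suc k))
  [k+1]*[n+1]C[k+1]≡[n+1]*nCk (suc n) zero    rewrite nC1≡n (suc (suc n)) = ℕ.*-comm 1 (suc (suc n))
  [k+1]*[n+1]C[k+1]≡[n+1]*nCk (suc n) (suc k) = begin
    suc (suc k) ℕ.* (suc (suc n) C suc (suc k))
      ≡⟨ cong (suc (suc k) ℕ.*_) (nCk+nC[k+1]≡[n+1]C[k+1] (suc n) (suc k)) ⟨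
    suc (suc k) ℕ.* (A ℕ.+ B)
      ≡⟨ expand k A B ⟩
    A ℕ.+ suc k ℕ.* A ℕ.+ suc (suc k) ℕ.* B
      ≡⟨ cong₂ (λ x y → A ℕ.+ x ℕ.+ y) ([k+1]*[n+1]C[k+1]≡[n+1]*nCk n k) ([k+1]*[n+1]C[k+1]≡[n+1]*nCk n (suc k)) ⟩
    A ℕ.+ suc n ℕ.* (n C k) ℕ.+ suc n ℕ.* (n C suc k)
      ≡⟨ collect A (suc n) (n C k) (n C suc k) ⟩
    A ℕ.+ suc n ℕ.* (n C k ℕ.+ n C suc k)
      ≡⟨ cong (λ c → A ℕ.+ suc n ℕ.* c) (nCk+nC[k+1]≡[n+1]C[k+1] n k) ⟩
    A ℕ.+ suc n ℕ.* A
      ∎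
    where
    open ≡-Reasoning
    A = suc n C suc k
    B = suc n C suc (suc k)
    expand : ∀ k A B → suc (suc k) ℕ.* (A ℕ.+ B) ≡ A ℕ.+ suc k ℕ.* A ℕ.+ suc (suc k) ℕ.* B
    expand = ℕ-Solver.solve-∀
    collect : ∀ A m c c′ → A ℕ.+ m ℕ.* c ℕ.+ m ℕ.* c′ ≡ A ℕ.+ m ℕ.* (c ℕ.+ c′)
    collect = ℕ-Solver.solve-∀

  prime∣pC[k+1] : ∀ {d} → Prime (suc d) → ∀ k → k < d → suc d ℕ.∣ suc d C suc k
  prime∣pC[k+1] {d} p-prime k k<d
    with euclidsLemma (suc k) (suc d C suc k) p-prime
           (ℕ.divides (d C k) (trans ([k+1]*[n+1]C[k+1]≡[n+1]*nCk d k) (ℕ.*-comm (suc d) (d C k))))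
  ... | inj₁ p∣k+1 = contradiction (ℕ.∣⇒≤ p∣k+1) (ℕ.<⇒≱ (s≤s k<d))
  ... | inj₂ p∣pC[k+1] = p∣pC[k+1]

  signedBinomial : ℕ → ℕ → ℤ
  signedBinomial n k = + (n C k) * (- 1ℤ) ^ k

  signedBinomial-suc : ∀ n k → signedBinomial (suc n) (suc k) ≡ signedBinomial n (suc k) - signedBinomial n k
  signedBinomial-suc n k = begin
    + (suc n C suc k) * (- 1ℤ) ^ suc k
      ≡⟨ cong (λ c → + c * (- 1ℤ) ^ suc k) (nCk+nC[k+1]≡[n+1]C[k+1] n k) ⟨
    + (n C k ℕ.+ n C suc k) * (- 1ℤ) ^ suc k
      ≡⟨ cong (_* (- 1ℤ) ^ suc k) (pos-+ (n C k) (n C suc k)) ⟩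
    (+ (n C k) + + (n C suc k)) * (- 1ℤ * (- 1ℤ) ^ k)
      ≡⟨ distribute (+ (n C k)) (+ (n C suc k)) ((- 1ℤ) ^ k) ⟩
    + (n C suc k) * (- 1ℤ * (- 1ℤ) ^ k) - + (n C k) * (- 1ℤ) ^ k
      ∎
    where
    open ≡-Reasoning
    distribute : ∀ a b s → (a + b) * (- 1ℤ * s) ≡ b * (- 1ℤ * s) - a * s
    distribute = solve-∀

  signedBinomial-vanishes : ∀ n → signedBinomial n (suc n) ≡ 0ℤ
  signedBinomial-vanishes n = cong (λ c → + c * (- 1ℤ) ^ suc n) (k>n⇒nCk≡0 (ℕ.n<1+n n))

  prime∣signedBinomial[p-1]-1 : ∀ {d} → Prime (suc d) → ∀ k → k ≤ d → + suc d ∣ signedBinomial d k - 1ℤ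
  prime∣signedBinomial[p-1]-1 p-prime zero    _    = divides 0ℤ refl
  prime∣signedBinomial[p-1]-1 {d} p-prime (suc k) k<d =
    subst (+ suc d ∣_) regroup (∣m∣n⇒∣m+n p∣pC[k+1] (prime∣signedBinomial[p-1]-1 p-prime k (ℕ.<⇒≤ k<d)))
    where
    p∣pC[k+1] : + suc d ∣ signedBinomial (suc d) (suc k)
    p∣pC[k+1] = ∣m⇒∣m*n {m = + (suc d C suc k)} ((- 1ℤ) ^ suc k) (∣ᵤ⇒∣ (prime∣pC[k+1] p-prime k k<d))
    cancel : ∀ b c → b - c + (c - 1ℤ) ≡ b - 1ℤ
    cancel = solve-∀
    regroup : signedBinomial (suc d) (suc k) + (signedBinomial d k - 1ℤ) ≡ signedBinomial d (suc k) - 1ℤ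
    regroup = trans (cong (_+ (signedBinomial d k - 1ℤ)) (signedBinomial-suc d k))
                    (cancel (signedBinomial d (suc k)) (signedBinomial d k))

  sumTo-signedBinomial-suc : ∀ n (h : ℕ → ℤ) →
    sumTo (suc n) (λ k → signedBinomial (suc n) k * h k) ≡ sumTo n (λ k → signedBinomial n k * (h k - h (suc k)))
  sumTo-signedBinomial-suc n h = begin
    sumTo (suc n) (λ k → b (suc n) k * h k)
      ≡⟨ sumTo-shift n _ ⟩
    b n 0 * h 0 + sumTo n (λ k → b (suc n) (suc k) * h (suc k))
      ≡⟨ cong (_+_ (b n 0 * h 0)) (sumTo-cong n (λ k → cong (_* h (suc k)) (signedBinomial-suc n k))) ⟩
    b n 0 * h 0 + sumTo n (λ k → (b n (suc k) - b n k) * h (suc k))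
      ≡⟨ cong (_+_ (b n 0 * h 0)) (sumTo-cong n (λ k → *-distribʳ-minus (b n (suc k)) (b n k) (h (suc k)))) ⟩
    b n 0 * h 0 + sumTo n (λ k → b n (suc k) * h (suc k) - b n k * h (suc k))
      ≡⟨ cong (_+_ (b n 0 * h 0)) (sumTo-distrib-minus n _ _) ⟩
    b n 0 * h 0 + (sumTo n (λ k → b n (suc k) * h (suc k)) - sumTo n (λ k → b n k * h (suc k)))
      ≡⟨ +-minus-assoc (b n 0 * h 0) _ _ ⟨
    b n 0 * h 0 + sumTo n (λ k → b n (suc k) * h (suc k)) - sumTo n (λ k → b n k * h (suc k))
      ≡⟨ cong (_- sumTo n (λ k → b n k * h (suc k))) (sumTo-shift n (λ k → b n k * h k)) ⟨
    sumTo n (λ k → b n k * h k) + b n (suc n) * h (suc n) - sumTo n (λ k → b n k * h (suc k))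
      ≡⟨ cong (λ c → sumTo n (λ k → b n k * h k) + c * h (suc n) - sumTo n (λ k → b n k * h (suc k)))
              (signedBinomial-vanishes n) ⟩
    sumTo n (λ k → b n k * h k) + 0ℤ * h (suc n) - sumTo n (λ k → b n k * h (suc k))
      ≡⟨ cong (_- sumTo n (λ k → b n k * h (suc k))) (+-identityʳ (sumTo n (λ k → b n k * h k))) ⟩
    sumTo n (λ k → b n k * h k) - sumTo n (λ k → b n k * h (suc k))
      ≡⟨ sumTo-distrib-minus n _ _ ⟨
    sumTo n (λ k → b n k * h k - b n k * h (suc k))
      ≡⟨ sumTo-cong n (λ k → *-distribˡ-minus (b n k) (h k) (h (suc k))) ⟨
    sumTo n (λ k → b n k * (h k - h (suc k)))
      ∎
    where
    open ≡-Reasoning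
    b = signedBinomial
    +-minus-assoc : ∀ x y z → x + y - z ≡ x + (y - z)
    +-minus-assoc = solve-∀

  binomℤ-zero : ∀ x → binomℤ x 0 ≡ 1ℤ
  binomℤ-zero (+ m)    = refl
  binomℤ-zero -[1+ m ] = refl

  binomℤ-pascal : ∀ x l → binomℤ (x + 1ℤ) (suc l) ≡ binomℤ x (suc l) + binomℤ x l
  binomℤ-pascal (+ m) l = begin
    + ((m ℕ.+ 1) C suc l)           ≡⟨ cong (λ k → + (k C suc l)) (ℕ.+-comm m 1) ⟩
    + (suc m C suc l)               ≡⟨ cong +_ (nCk+nC[k+1]≡[n+1]C[k+1] m l) ⟨
    + (m C l ℕ.+ m C suc l)         ≡⟨ pos-+ (m C l) (m C suc l) ⟩
    + (m C l) + + (m C suc l)       ≡⟨ +-comm (+ (m C l)) (+ (m C suc l)) ⟩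
    + (m C suc l) + + (m C l)       ∎
    where open ≡-Reasoning
  binomℤ-pascal -[1+ zero ] l rewrite nCn≡1 l | nCn≡1 (suc l) = cancel ((- 1ℤ) ^ l)
    where
    cancel : ∀ s → 0ℤ ≡ - 1ℤ * s * + 1 + s * + 1
    cancel = solve-∀
  binomℤ-pascal -[1+ suc a ] l = begin
    - 1ℤ * s * + ((a ℕ.+ suc l) C suc l)
      ≡⟨ cong (λ k → - 1ℤ * s * + (k C suc l)) (ℕ.+-suc a l) ⟩
    - 1ℤ * s * + (N C suc l)
      ≡⟨ rearrange s (+ (N C l)) (+ (N C suc l)) ⟩
    - 1ℤ * s * (+ (N C l) + + (N C suc l)) + s * + (N C l)
      ≡⟨ cong (λ c → - 1ℤ * s * c + s * + (N C l)) pascal ⟩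
    - 1ℤ * s * + (suc N C suc l) + s * + (N C l)
      ≡⟨ cong (λ k → - 1ℤ * s * + (k C suc l) + s * + (N C l)) (ℕ.+-suc (suc a) l) ⟨
    - 1ℤ * s * + ((suc a ℕ.+ suc l) C suc l) + s * + (N C l)
      ∎
    where
    open ≡-Reasoning
    s = (- 1ℤ) ^ l
    N = suc a ℕ.+ l
    rearrange : ∀ s x y → - 1ℤ * s * y ≡ - 1ℤ * s * (x + y) + s * x
    rearrange = solve-∀
    pascal : + (N C l) + + (N C suc l) ≡ + (suc N C suc l)
    pascal = trans (sym (pos-+ (N C l) (N C suc l))) (cong +_ (nCk+nC[k+1]≡[n+1]C[k+1] N l))

  binomℤ-pascal-sub : ∀ x l → binomℤ x (suc l) ≡ binomℤ (x + 1ℤ) (suc l) - binomℤ x l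
  binomℤ-pascal-sub x l = sym (trans (cong (_- binomℤ x l) (binomℤ-pascal x l)) (cancel (binomℤ x (suc l)) (binomℤ x l)))
    where
    cancel : ∀ a b → a + b - b ≡ a
    cancel = solve-∀

  -- Backward differences and convolutions

  ∇ : (ℤ → ℤ) → ℤ → ℤ
  ∇ f x = f x - f (x - 1ℤ)

  ∇^ : ℕ → (ℤ → ℤ) → ℤ → ℤ
  ∇^ zero    f = f
  ∇^ (suc n) f = ∇^ n (∇ f)

  ∇^-cong : ∀ n {f g : ℤ → ℤ} → f ≗ g → ∇^ n f ≗ ∇^ n g
  ∇^-cong zero    f≗g = f≗g
  ∇^-cong (suc n) f≗g = ∇^-cong n (λ x → cong₂ _-_ (f≗g x) (f≗g (x - 1ℤ)))

  ∇^-+ : ∀ m n f → ∇^ (m ℕ.+ n) f ≗ ∇^ n (∇^ m f)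
  ∇^-+ zero    n f x = refl
  ∇^-+ (suc m) n f   = ∇^-+ m n (∇ f)

  ∇^-distrib-+ : ∀ n f g x → ∇^ n (λ y → f y + g y) x ≡ ∇^ n f x + ∇^ n g x
  ∇^-distrib-+ zero    f g x = refl
  ∇^-distrib-+ (suc n) f g x =
    trans (∇^-cong n (λ y → interchange (f y) (g y) (f (y - 1ℤ)) (g (y - 1ℤ))) x) (∇^-distrib-+ n (∇ f) (∇ g) x)
    where
    interchange : ∀ a b c d → a + b - (c + d) ≡ a - c + (b - d)
    interchange = solve-∀

  ∇^-neg : ∀ n f x → ∇^ n (λ y → - f y) x ≡ - ∇^ n f x
  ∇^-neg zero    f x = refl
  ∇^-neg (suc n) f x = trans (∇^-cong n (λ y → neg-minus (f y) (f (y - 1ℤ))) x) (∇^-neg n (∇ f) x)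
    where
    neg-minus : ∀ a b → - a - - b ≡ - (a - b)
    neg-minus = solve-∀

  ∇^-zero : ∀ n x → ∇^ n (λ _ → 0ℤ) x ≡ 0ℤ
  ∇^-zero zero    x = refl
  ∇^-zero (suc n) x = ∇^-zero n x

  convolve : ℕ → (ℕ → ℤ) → (ℤ → ℤ) → ℤ → ℤ
  convolve n c f x = sumTo n (λ k → c k * f (x - + k))

  convolve-split : ∀ n c c′ f x → convolve n c f x ≡ convolve n (λ k → c k - c′ k) f x + convolve n c′ f x
  convolve-split n c c′ f x = trans (sumTo-cong n (λ k → split (c k) (c′ k) (f (x - + k))))
                                    (sumTo-distrib-+ n _ _)
    where
    split : ∀ a b y → a * y ≡ (a - b) * y + b * y
    split = solve-∀

  convolve-linear : ∀ n c f g a x → convolve n c (λ y → f y - a * g y) x ≡ convolve n c f x - a * convolve n c g x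
  convolve-linear n c f g a x = begin
    sumTo n (λ k → c k * (f (x - + k) - a * g (x - + k)))
      ≡⟨ sumTo-cong n (λ k → distribute (c k) (f (x - + k)) a (g (x - + k))) ⟩
    sumTo n (λ k → c k * f (x - + k) - a * (c k * g (x - + k)))
      ≡⟨ sumTo-distrib-minus n _ _ ⟩
    convolve n c f x - sumTo n (λ k → a * (c k * g (x - + k)))
      ≡⟨ cong (_-_ (convolve n c f x)) (*-distribˡ-sumTo n a _) ⟨
    convolve n c f x - a * convolve n c g x
      ∎
    where
    open ≡-Reasoning
    distribute : ∀ c y a z → c * (y - a * z) ≡ c * y - a * (c * z)
    distribute = solve-∀

  ∇-convolve : ∀ n c f x → ∇ (convolve n c f) x ≡ convolve n c (∇ f) x
  ∇-convolve n c f x = trans (sym (sumTo-distrib-minus n _ _)) (sumTo-cong n (λ k →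
      trans (cong (λ y → c k * f (x - + k) - c k * f y) (reorder x (+ k)))
            (sym (*-distribˡ-minus (c k) (f (x - + k)) (f (x - + k - 1ℤ))))))
    where
    reorder : ∀ x k → x - 1ℤ - k ≡ x - k - 1ℤ
    reorder = solve-∀

  ∇^-convolve : ∀ m n c f x → ∇^ m (convolve n c f) x ≡ convolve n c (∇^ m f) x
  ∇^-convolve zero    n c f x = refl
  ∇^-convolve (suc m) n c f x = trans (∇^-cong m (∇-convolve n c f) x) (∇^-convolve m n c (∇ f) x)

  ∇^≡convolve-signedBinomial : ∀ n f x → ∇^ n f x ≡ convolve n (signedBinomial n) f x
  ∇^≡convolve-signedBinomial zero    f x = trans (cong f (sym (+-identityʳ x))) (sym (*-identityˡ (f (x - 0ℤ))))
  ∇^≡convolve-signedBinomial (suc n) f x = begin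
    ∇^ n (∇ f) x
      ≡⟨ ∇^≡convolve-signedBinomial n (∇ f) x ⟩
    sumTo n (λ k → signedBinomial n k * (f (x - + k) - f (x - + k - 1ℤ)))
      ≡⟨ sumTo-cong n (λ k → cong (λ y → signedBinomial n k * (f (x - + k) - f y)) (x-k-1≡x-[1+k] x k)) ⟩
    sumTo n (λ k → signedBinomial n k * (f (x - + k) - f (x - + suc k)))
      ≡⟨ sumTo-signedBinomial-suc n (λ k → f (x - + k)) ⟨
    convolve (suc n) (signedBinomial (suc n)) f x
      ∎
    where open ≡-Reasoning

  convolve-1-∇ : ∀ n f x → convolve n (λ _ → 1ℤ) (∇ f) x ≡ f x - f (x - + suc n)
  convolve-1-∇ n f x = begin
    sumTo n (λ k → 1ℤ * (f (x - + k) - f (x - + k - 1ℤ)))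
      ≡⟨ sumTo-cong n (λ k → trans (*-identityˡ _) (cong (λ y → f (x - + k) - f y) (x-k-1≡x-[1+k] x k))) ⟩
    sumTo n (λ k → f (x - + k) - f (x - + suc k))
      ≡⟨ sumTo-telescope n (λ k → f (x - + k)) ⟩
    f (x - 0ℤ) - f (x - + suc n)
      ≡⟨ cong (λ y → f y - f (x - + suc n)) (+-identityʳ x) ⟩
    f x - f (x - + suc n)
      ∎
    where open ≡-Reasoning

  ∣-convolve : ∀ {a b} n c f x → (∀ k → k ≤ n → a ∣ c k) → (∀ y → b ∣ f y) → a * b ∣ convolve n c f x
  ∣-convolve {a} {b} n c f x a∣c b∣f =
    ∣-sumTo n _ (λ k k≤n → ∣-trans (*-monoˡ-∣ b (a∣c k k≤n)) (*-monoʳ-∣ (c k) (b∣f (x - + k))))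

  -- By ∇^≡convolve-signedBinomial, defect d f = ∇^ d f − Σ_{k ≤ d} f (· − k).
  defect : ℕ → (ℤ → ℤ) → ℤ → ℤ
  defect d = convolve d (λ k → signedBinomial d k - 1ℤ)

  defect-linear : ∀ d f g a x → defect d (λ y → f y - a * g y) x ≡ defect d f x - a * defect d g x
  defect-linear d = convolve-linear d (λ k → signedBinomial d k - 1ℤ)

  ∇^-suc-decomposition : ∀ d f x → ∇^ (suc d) f x ≡ defect d (∇ f) x + (f x - f (x - + suc d))
  ∇^-suc-decomposition d f x = begin
    ∇^ d (∇ f) x
      ≡⟨ ∇^≡convolve-signedBinomial d (∇ f) x ⟩
    convolve d (signedBinomial d) (∇ f) x
      ≡⟨ convolve-split d (signedBinomial d) (λ _ → 1ℤ) (∇ f) x ⟩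
    defect d (∇ f) x + convolve d (λ _ → 1ℤ) (∇ f) x
      ≡⟨ cong (_+_ (defect d (∇ f) x)) (convolve-1-∇ d f x) ⟩
    defect d (∇ f) x + (f x - f (x - + suc d))
      ∎
    where open ≡-Reasoning

  ∇^-step : ∀ d n f x → ∇^ (suc d ℕ.+ n) f x ≡ defect d (∇^ (suc n) f) x + ∇^ n (λ y → f y - f (y - + suc d)) x
  ∇^-step d n f x = begin
    ∇^ (suc d ℕ.+ n) f x
      ≡⟨ ∇^-+ (suc d) n f x ⟩
    ∇^ n (∇^ (suc d) f) x
      ≡⟨ ∇^-cong n (∇^-suc-decomposition d f) x ⟩
    ∇^ n (λ y → defect d (∇ f) y + f-f[·-p] y) x
      ≡⟨ ∇^-distrib-+ n _ _ x ⟩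
    ∇^ n (defect d (∇ f)) x + ∇^ n f-f[·-p] x
      ≡⟨ cong (_+ ∇^ n f-f[·-p] x) (∇^-convolve n d (λ k → signedBinomial d k - 1ℤ) (∇ f) x) ⟩
    defect d (∇^ n (∇ f)) x + ∇^ n f-f[·-p] x
      ∎
    where
    open ≡-Reasoning
    f-f[·-p] : ℤ → ℤ
    f-f[·-p] y = f y - f (y - + suc d)

  ∣-defect : ∀ {d} → Prime (suc d) → ∀ e f → (∀ y → + (suc d ℕ.^ e) ∣ f y) →
             ∀ x → + (suc d ℕ.^ suc e) ∣ defect d f x
  ∣-defect {d} p-prime e f pᵉ∣f x = subst (_∣ defect d f x) (sym (pos-* (suc d) (suc d ℕ.^ e)))
    (∣-convolve d _ f x (prime∣signedBinomial[p-1]-1 p-prime) pᵉ∣f)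

  -- The sums S⁽ l ⁾ n

  sparseBinom : ℕ → ℕ → ℤ → ℤ
  sparseBinom p l x = if divides? p x then binomℤ (fdiv x p) l else 0ℤ

  module _ (d : ℕ) where

    private
      p : ℕ
      p = suc d

    divides?≡[%ℕ≡ᵇ0] : ∀ x → divides? p x ≡ (x %ℕ p ℕ.≡ᵇ 0)
    divides?≡[%ℕ≡ᵇ0] x with x %ℕ p
    ... | zero  = refl
    ... | suc _ = refl

    sparseBinom[x+p] : ∀ l x → sparseBinom p l (x + + p) ≡ (if divides? p x then binomℤ (fdiv x p + 1ℤ) l else 0ℤ)
    sparseBinom[x+p] l x = cong₂ (λ b y → if b then binomℤ y l else 0ℤ) divides?-+p ([x+m]/ℕm≡x/ℕm+1 p x)
      where
      divides?-+p : divides? p (x + + p) ≡ divides? p x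
      divides?-+p = trans (divides?≡[%ℕ≡ᵇ0] (x + + p))
                          (trans (cong (ℕ._≡ᵇ 0) ([x+m]%ℕm≡x%ℕm p x)) (sym (divides?≡[%ℕ≡ᵇ0] x)))

    sparseBinom-difference-suc : ∀ l x → sparseBinom p (suc l) x - sparseBinom p (suc l) (x + + p) ≡ - sparseBinom p l x
    sparseBinom-difference-suc l x =
      trans (cong (_-_ (sparseBinom p (suc l) x)) (sparseBinom[x+p] (suc l) x)) (by-cases (divides? p x))
      where
      y = fdiv x p
      cancel : ∀ a b → a - (a + b) ≡ - b
      cancel = solve-∀
      by-cases : ∀ b → (if b then binomℤ y (suc l) else 0ℤ) - (if b then binomℤ (y + 1ℤ) (suc l) else 0ℤ)
                       ≡ - (if b then binomℤ y l else 0ℤ)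
      by-cases true  = trans (cong (_-_ (binomℤ y (suc l))) (binomℤ-pascal y l)) (cancel (binomℤ y (suc l)) (binomℤ y l))
      by-cases false = refl

    sparseBinom-difference-zero : ∀ x → sparseBinom p 0 x - sparseBinom p 0 (x + + p) ≡ 0ℤ
    sparseBinom-difference-zero x =
      trans (cong (_-_ (sparseBinom p 0 x)) (sparseBinom[x+p] 0 x)) (by-cases (divides? p x))
      where
      y = fdiv x p
      by-cases : ∀ b → (if b then binomℤ y 0 else 0ℤ) - (if b then binomℤ (y + 1ℤ) 0 else 0ℤ) ≡ 0ℤ
      by-cases true  = cong₂ _-_ (binomℤ-zero y) (binomℤ-zero (y + 1ℤ))
      by-cases false = refl

    S⁽_⁾ : ℕ → ℕ → ℤ → ℤ
    S⁽ l ⁾ n = ∇^ n (λ y → sparseBinom p l (- y))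

    private
      -[y-p]≡-y+p : ∀ y → - (y - + p) ≡ - y + + p
      -[y-p]≡-y+p y = neg-minus y (+ p)
        where
        neg-minus : ∀ a b → - (a - b) ≡ - a + b
        neg-minus = solve-∀

    S⁽0⁾-step : ∀ e s x → S⁽ 0 ⁾ (suc (suc e ℕ.* d ℕ.+ s)) x ≡ defect d (S⁽ 0 ⁾ (suc (e ℕ.* d ℕ.+ s))) x
    S⁽0⁾-step e s x = begin
      S⁽ 0 ⁾ (suc (d ℕ.+ e ℕ.* d ℕ.+ s)) x
        ≡⟨ cong (λ n → S⁽ 0 ⁾ (suc n) x) (ℕ.+-assoc d (e ℕ.* d) s) ⟩
      ∇^ (p ℕ.+ n) g x
        ≡⟨ ∇^-step d n g x ⟩
      defect d (S⁽ 0 ⁾ (suc n)) x + ∇^ n (λ y → g y - g (y - + p)) x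
        ≡⟨ cong (_+_ (defect d (S⁽ 0 ⁾ (suc n)) x)) (trans (∇^-cong n g[y]-g[y-p]≡0 x) (∇^-zero n x)) ⟩
      defect d (S⁽ 0 ⁾ (suc n)) x + 0ℤ
        ≡⟨ +-identityʳ _ ⟩
      defect d (S⁽ 0 ⁾ (suc n)) x
        ∎
      where
      open ≡-Reasoning
      n = e ℕ.* d ℕ.+ s
      g : ℤ → ℤ
      g y = sparseBinom p 0 (- y)
      g[y]-g[y-p]≡0 : ∀ y → g y - g (y - + p) ≡ 0ℤ
      g[y]-g[y-p]≡0 y = trans (cong (λ z → g y - sparseBinom p 0 z) (-[y-p]≡-y+p y)) (sparseBinom-difference-zero (- y))

    S⁽⁾-step : ∀ l n x → S⁽ suc l ⁾ (suc l ℕ.* p ℕ.+ n) x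
                         ≡ defect d (S⁽ suc l ⁾ (suc (l ℕ.* p ℕ.+ n))) x - S⁽ l ⁾ (l ℕ.* p ℕ.+ n) x
    S⁽⁾-step l n x = begin
      S⁽ suc l ⁾ (p ℕ.+ l ℕ.* p ℕ.+ n) x
        ≡⟨ cong (λ m → S⁽ suc l ⁾ m x) (ℕ.+-assoc p (l ℕ.* p) n) ⟩
      ∇^ (p ℕ.+ m) (g (suc l)) x
        ≡⟨ ∇^-step d m (g (suc l)) x ⟩
      defect d (S⁽ suc l ⁾ (suc m)) x + ∇^ m (λ y → g (suc l) y - g (suc l) (y - + p)) x
        ≡⟨ cong (_+_ (defect d (S⁽ suc l ⁾ (suc m)) x)) (trans (∇^-cong m g[y]-g[y-p]≡-g[y] x) (∇^-neg m (g l) x)) ⟩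
      defect d (S⁽ suc l ⁾ (suc m)) x - S⁽ l ⁾ m x
        ∎
      where
      open ≡-Reasoning
      m = l ℕ.* p ℕ.+ n
      g : ℕ → ℤ → ℤ
      g l y = sparseBinom p l (- y)
      g[y]-g[y-p]≡-g[y] : ∀ y → g (suc l) y - g (suc l) (y - + p) ≡ - g l y
      g[y]-g[y-p]≡-g[y] y = trans (cong (λ z → g (suc l) y - sparseBinom p (suc l) z) (-[y-p]≡-y+p y))
                                  (sparseBinom-difference-suc l (- y))

    flSum≡S⁽⁾ : ∀ l n r → flSum l p n r ≡ S⁽ l ⁾ n r
    flSum≡S⁽⁾ l n r = sym (trans (∇^≡convolve-signedBinomial n _ r) (sumTo-cong n (λ k →
      trans (cong (λ z → signedBinomial n k * sparseBinom p l z) (neg-minus r (+ k)))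
            (*-if (divides? p (+ k - r)) (signedBinomial n k) (binomℤ (fdiv (+ k - r) p) l)))))
      where
      neg-minus : ∀ r k → - (r - k) ≡ k - r
      neg-minus = solve-∀
      *-if : ∀ b x y → x * (if b then y else 0ℤ) ≡ (if b then x * y else 0ℤ)
      *-if true  x y = refl
      *-if false x y = *-zeroʳ x

    fleckSum≡S⁽0⁾ : ∀ n r → sumTo n (λ k → if divides? p (+ k - r) then + (n C k) * (- 1ℤ) ^ k else 0ℤ)
                          ≡ S⁽ 0 ⁾ n r
    fleckSum≡S⁽0⁾ n r = trans (sumTo-cong n (λ k → cong (λ b → if divides? p (+ k - r) then b else 0ℤ)
                                                        (sym (*-binomℤ-zero (signedBinomial n k) (fdiv (+ k - r) p)))))
                              (flSum≡S⁽⁾ 0 n r)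
      where
      *-binomℤ-zero : ∀ x y → x * binomℤ y 0 ≡ x
      *-binomℤ-zero x y = trans (cong (x *_) (binomℤ-zero y)) (*-identityʳ x)

    F⁽⁾≡S⁽⁾ : ∀ l e s r → s < d → let n = l ℕ.* p ℕ.+ suc (e ℕ.* d ℕ.+ s) in
      F⁽ l ⁾ p n r ≡ (- 1ℤ) ^ e * fdiv (S⁽ l ⁾ n r) (p ℕ.^ e)
    F⁽⁾≡S⁽⁾ l e s r s<d = cong₂ (scaleNegP p)
      (trans (cong (λ z → fdiv z d) (+[a+suc[c]]-+a-1≡+c (l ℕ.* p) (e ℕ.* d ℕ.+ s))) (fdiv-affine d e s s<d))
      (flSum≡S⁽⁾ l (l ℕ.* p ℕ.+ suc (e ℕ.* d ℕ.+ s)) r)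

    Fleck≡S⁽0⁾ : ∀ e s r → s < d → let m = e ℕ.* d ℕ.+ s in
      Fleck p (suc m) r ≡ (- 1ℤ) ^ e * fdiv (S⁽ 0 ⁾ (suc m) r) (p ℕ.^ e)
    Fleck≡S⁽0⁾ e s r s<d =
      trans (+-identityʳ _) (cong₂ (scaleNegP p) (fdiv-affine d e s s<d) (fleckSum≡S⁽0⁾ (suc (e ℕ.* d ℕ.+ s)) r))

    fdiv[n-l-1]≡e+l : ∀ l e s → s < d → fdiv (+ (l ℕ.* p ℕ.+ suc (e ℕ.* d ℕ.+ s)) - + l - 1ℤ) d ≡ + (e ℕ.+ l)
    fdiv[n-l-1]≡e+l l e s s<d = begin
      fdiv (+ (l ℕ.* p ℕ.+ suc (e ℕ.* d ℕ.+ s)) - + l - 1ℤ) d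
        ≡⟨ cong (λ k → fdiv (+ k - + l - 1ℤ) d) (regroup l e s d) ⟩
      fdiv (+ (l ℕ.+ suc ((e ℕ.+ l) ℕ.* d ℕ.+ s)) - + l - 1ℤ) d
        ≡⟨ cong (λ z → fdiv z d) (+[a+suc[c]]-+a-1≡+c l _) ⟩
      fdiv (+ ((e ℕ.+ l) ℕ.* d ℕ.+ s)) d
        ≡⟨ fdiv-affine d (e ℕ.+ l) s s<d ⟩
      + (e ℕ.+ l)
        ∎
      where
      open ≡-Reasoning
      regroup : ∀ l e s d → l ℕ.* suc d ℕ.+ suc (e ℕ.* d ℕ.+ s) ≡ l ℕ.+ suc ((e ℕ.+ l) ℕ.* d ℕ.+ s)
      regroup = ℕ-Solver.solve-∀

    module _ (p-prime : Prime p) where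

      pᵉ∣S⁽0⁾ : ∀ e s x → + (p ℕ.^ e) ∣ S⁽ 0 ⁾ (suc (e ℕ.* d ℕ.+ s)) x
      pᵉ∣S⁽0⁾ zero    s x = 1∣ _
      pᵉ∣S⁽0⁾ (suc e) s x =
        subst (+ (p ℕ.^ suc e) ∣_) (sym (S⁽0⁾-step e s x)) (∣-defect p-prime e _ (pᵉ∣S⁽0⁾ e s) x)

      S⁽⁾-congruence : ∀ l e s x → let n = suc (e ℕ.* d ℕ.+ s) in
        + (p ℕ.^ suc e) ∣ S⁽ l ⁾ (l ℕ.* p ℕ.+ n) x - binomℤ -[1+ e ] l * S⁽ 0 ⁾ n x
      S⁽⁾-congruence zero e s x = divides 0ℤ (x-1x≡0 (S⁽ 0 ⁾ (suc (e ℕ.* d ℕ.+ s)) x))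
        where
        x-1x≡0 : ∀ x → x - 1ℤ * x ≡ 0ℤ
        x-1x≡0 = solve-∀
      S⁽⁾-congruence (suc l) zero s x =
        subst (+ p ℕ.^ 1 ∣_) (sym decompose)
          (∣-combine {D = D} {A} {B} {0ℤ} {b} p∣D-0B (S⁽⁾-congruence l zero s x))
        where
        D = defect d (S⁽ suc l ⁾ (suc (l ℕ.* p ℕ.+ suc s))) x
        A = S⁽ l ⁾ (l ℕ.* p ℕ.+ suc s) x
        B = S⁽ 0 ⁾ (suc s) x
        b = binomℤ -[1+ 0 ] l
        x-0y≡x : ∀ x y → x - 0ℤ * y ≡ x
        x-0y≡x = solve-∀
        p∣D-0B : + (p ℕ.^ 1) ∣ D - 0ℤ * B
        p∣D-0B = subst (+ p ℕ.^ 1 ∣_) (sym (x-0y≡x D B))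
                   (∣-defect p-prime 0 (S⁽ suc l ⁾ (suc (l ℕ.* p ℕ.+ suc s))) (λ y → 1∣ _) x)
        decompose : S⁽ suc l ⁾ (suc l ℕ.* p ℕ.+ suc s) x - binomℤ -[1+ 0 ] (suc l) * B ≡ D - A - (0ℤ - b) * B
        decompose = cong₂ (λ S c → S - c * B) (S⁽⁾-step l (suc s) x) (binomℤ-pascal-sub -[1+ 0 ] l)
      S⁽⁾-congruence (suc l) (suc e) s x =
        subst (+ p ℕ.^ suc (suc e) ∣_) (sym decompose)
          (∣-combine {D = D} {A} {B} {b₁} {b₂} pᵉ⁺²∣D-b₁B (S⁽⁾-congruence l (suc e) s x))
        where
        n = suc (suc e ℕ.* d ℕ.+ s)
        m = suc (e ℕ.* d ℕ.+ s)
        D = defect d (S⁽ suc l ⁾ (suc (l ℕ.* p ℕ.+ n))) x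
        A = S⁽ l ⁾ (l ℕ.* p ℕ.+ n) x
        B = S⁽ 0 ⁾ n x
        b₁ = binomℤ -[1+ e ] (suc l)
        b₂ = binomℤ -[1+ suc e ] l
        reassociate : ∀ l e s d → suc (l ℕ.* suc d ℕ.+ suc (d ℕ.+ e ℕ.* d ℕ.+ s))
                                 ≡ suc d ℕ.+ l ℕ.* suc d ℕ.+ suc (e ℕ.* d ℕ.+ s)
        reassociate = ℕ-Solver.solve-∀
        defect[S-b₁S]≡D-b₁B : defect d (λ y → S⁽ suc l ⁾ (suc l ℕ.* p ℕ.+ m) y - b₁ * S⁽ 0 ⁾ m y) x ≡ D - b₁ * B
        defect[S-b₁S]≡D-b₁B = trans (defect-linear d (S⁽ suc l ⁾ (suc l ℕ.* p ℕ.+ m)) (S⁽ 0 ⁾ m) b₁ x)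
                              (cong₂ (λ S T → S - b₁ * T)
                                     (cong (λ k → defect d (S⁽ suc l ⁾ k) x) (sym (reassociate l e s d)))
                                     (sym (S⁽0⁾-step e s x)))
        pᵉ⁺²∣D-b₁B : + (p ℕ.^ suc (suc e)) ∣ D - b₁ * B
        pᵉ⁺²∣D-b₁B = subst (+ p ℕ.^ suc (suc e) ∣_) defect[S-b₁S]≡D-b₁B
                       (∣-defect p-prime (suc e) _ (S⁽⁾-congruence (suc l) e s) x)
        decompose : S⁽ suc l ⁾ (suc l ℕ.* p ℕ.+ n) x - binomℤ -[1+ suc e ] (suc l) * B ≡ D - A - (b₁ - b₂) * B
        decompose = cong₂ (λ S c → S - c * B) (S⁽⁾-step l n x) (binomℤ-pascal-sub -[1+ suc e ] l)

      F⁽⁾-congruence : ∀ l e s r → s < d → let n = l ℕ.* p ℕ.+ suc (e ℕ.* d ℕ.+ s) in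
        + p ∣ F⁽ l ⁾ p n r - (- 1ℤ) ^ l * binomℤ (fdiv (+ n - + l - 1ℤ) d) l * Fleck p (n ℕ.∸ l ℕ.* p) r
      F⁽⁾-congruence l e s r s<d = subst (+ p ∣_) (sym rescale) (∣n⇒∣m*n ((- 1ℤ) ^ e) p∣A/q-bB/q)
        where
        open ≡-Reasoning
        m = e ℕ.* d ℕ.+ s
        n = l ℕ.* p ℕ.+ suc m
        A = S⁽ l ⁾ n r
        B = S⁽ 0 ⁾ (suc m) r
        b = binomℤ -[1+ e ] l
        q = p ℕ.^ e
        p∣A/q-bB/q : + p ∣ fdiv A q - b * fdiv B q
        p∣A/q-bB/q = fdiv-congruence p q A B b {{ℕ.m^n≢0 p e}} (pᵉ∣S⁽0⁾ e s r)
                       (subst (_∣ A - b * B) (pos-* p q) (S⁽⁾-congruence l e s r))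
        factor : ∀ s x y b → s * x - b * (s * y) ≡ s * (x - b * y)
        factor = solve-∀
        rescale : F⁽ l ⁾ p n r - (- 1ℤ) ^ l * binomℤ (fdiv (+ n - + l - 1ℤ) d) l * Fleck p (n ℕ.∸ l ℕ.* p) r
                ≡ (- 1ℤ) ^ e * (fdiv A q - b * fdiv B q)
        rescale = begin
          F⁽ l ⁾ p n r - (- 1ℤ) ^ l * binomℤ (fdiv (+ n - + l - 1ℤ) d) l * Fleck p (n ℕ.∸ l ℕ.* p) r
            ≡⟨ cong₂ (λ F c → F - (- 1ℤ) ^ l * binomℤ c l * Fleck p (n ℕ.∸ l ℕ.* p) r)
                     (F⁽⁾≡S⁽⁾ l e s r s<d) (fdiv[n-l-1]≡e+l l e s s<d) ⟩
          (- 1ℤ) ^ e * fdiv A q - b * Fleck p (n ℕ.∸ l ℕ.* p) r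
            ≡⟨ cong (λ k → (- 1ℤ) ^ e * fdiv A q - b * Fleck p k r) (ℕ.m+n∸m≡n (l ℕ.* p) (suc m)) ⟩
          (- 1ℤ) ^ e * fdiv A q - b * Fleck p (suc m) r
            ≡⟨ cong (λ F → (- 1ℤ) ^ e * fdiv A q - b * F) (Fleck≡S⁽0⁾ e s r s<d) ⟩
          (- 1ℤ) ^ e * fdiv A q - b * ((- 1ℤ) ^ e * fdiv B q)
            ≡⟨ factor ((- 1ℤ) ^ e) (fdiv A q) (fdiv B q) b ⟩
          (- 1ℤ) ^ e * (fdiv A q - b * fdiv B q)
            ∎

open import Data.Nat using (ℕ; suc; _*_; _∸_; _<_)
open import Data.Nat.Primality using (Prime)
open import Data.Integer using (ℤ; +_; -_; _-_; _^_; 1ℤ)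
open import Data.Integer.Divisibility using (_∣_)
open import Data.Integer using () renaming (_*_ to _*ℤ_)
open import Data.Integer.Divisibility.Signed using (∣⇒∣ᵤ)
open import Data.Product using (_,_)
open import Relation.Binary.PropositionalEquality using (refl)
open FleckQuotients using (F⁽⁾-congruence; a<n⇒n≡a+suc[e*d+s])

lemma5p3 : (p : ℕ) → Prime p → (l n : ℕ) → (r : ℤ) → l * p < n →
    + p ∣ (F⁽ l ⁾ p n r - (- 1ℤ) ^ l *ℤ binomℤ (fdiv (+ n - + l - 1ℤ) (p ∸ 1)) l *ℤ Fleck p (n ∸ l * p) r)
lemma5p3 0 ()
lemma5p3 1 ()
lemma5p3 (suc (suc d)) p-prime l n r lp<n with a<n⇒n≡a+suc[e*d+s] (suc d) lp<n
... | e , s , s<d , refl = ∣⇒∣ᵤ (F⁽⁾-congruence (suc d) p-prime l e s r s<d)
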